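{- Let $n, r \geq 1$. For $0 \leq k \leq n$, \[ \operatorname{denom}\left( \frac{(n)_k}{(r+k)_k} \right) \mid \operatorname{denom}\left( \frac{(n)_n}{(r+n)_n} \right). \] If $n + r = p^e$ with $p$ a prime and $e \geq 1$, then for $0 \leq k < n$, \[ \operatorname{ord}_p\left( \frac{(r+n)_n}{n!} \right) > \operatorname{ord}_p\left( \frac{(r+k)_k}{(n)_k} \right). \]
   Context: $(m)_k = m(m-1)\cdots(m-k+1)$ is the falling factorial; $\operatorname{denom}(q)$ is the denominator of a rational $q$ in lowest terms; $\operatorname{ord}_p$ is the $p$-adic valuation on $\mathbb{Q}$. -}

module Defs where

open import Data.Nat using (ℕ; zero; suc; _+_; _*_; _∸_)
open import Data.Nat.Divisibility using (_∣?_)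
open import Data.Integer using (ℤ; +_; _-_; ∣_∣)
open import Data.Rational using (ℚ; _/_; ↥_; ↧ₙ_; 0ℚ)
open import Relation.Nullary using (yes; no)
import Data.Nat.DivMod

ff : ℕ → ℕ → ℕ
ff m zero    = 1
ff m (suc k) = ff m k * (m ∸ k)

-- the rational a / b (in lowest terms, by ℚ's normalisation);
-- only ever applied with b ≠ 0 (junk value 0 for b = 0)
frac : ℕ → ℕ → ℚ
frac a zero    = 0ℚ
frac a (suc b) = (+ a) Data.Rational./ suc b

-- p-adic valuation of a natural number, for p ≥ 2 and m ≥ 1:
-- number of times p divides m (fuel-bounded; fuel m suffices).
-- Junk value 0 for m = 0 or p ≤ 1.
vpFuel : ℕ → ℕ → ℕ → ℕ
vpFuel zero     p m = 0
vpFuel (suc f) zero m = 0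
vpFuel (suc f) (suc zero) m = 0
vpFuel (suc f) p@(suc (suc _)) zero = 0
vpFuel (suc f) p@(suc (suc _)) m@(suc _) with p ∣? m
... | yes _ = suc (vpFuel f p (m Data.Nat.DivMod./ p))
... | no  _ = 0

vp : ℕ → ℕ → ℕ
vp p m = vpFuel m p m

-- p-adic valuation on ℚ: ord_p(a/b) = v_p(|a|) - v_p(b), a/b in lowest terms
-- (junk value 0 at q = 0, never used below)
ord : ℕ → ℚ → ℤ
ord p q = (+ vp p ∣ ↥ q ∣) - (+ vp p (↧ₙ q))

module Submission where

-- Put N = r + n, K = C(N, n) and M = C(N, r + k).  Comparing factorials gives
-- (r+n)_n = n! K and (n)_k K = (r+k)_k M, so (n)_n/(r+n)_n = 1/K while the reduced
-- denominator of (n)_k/(r+k)_k divides K.  If N = p^e, the absorption identity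
-- C(N, m) m = N C(N-1, m-1) together with v_p(m) < e for 0 < m < p^e shows p ∣ M, hence
-- ord_p((r+k)_k/(n)_k) = v_p(K) - v_p(M) < v_p(K) = ord_p((r+n)_n/n!).

open import Data.Empty using (⊥-elim)
open import Data.Integer as ℤ using (+_; ∣_∣; _>_)
import Data.Integer.Properties as ℤ
open import Data.Nat.Base
  using ( ℕ; zero; suc; _+_; _*_; _^_; _∸_; _≤_; _<_; s≤s; z<s; _!
        ; NonZero; >-nonZero; >-nonZero⁻¹; NonTrivial; nonTrivial⇒n>1; nonTrivial⇒nonZero)
open import Data.Nat.Combinatorics using (k![n∸k]!∣n!; [n-k]*[n-k-1]!≡[n-k]!)
open import Data.Nat.Coprimality as Coprimality using (Coprime; coprime-divisor)
open import Data.Nat.Divisibility using (_∣_; divides; _∣?_; _∣0; ∣1⇒≡1; ∣-antisym; quotient)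
open import Data.Nat.DivMod using (_/_; m*n/n≡m)
open import Data.Nat.GCD using (gcd)
open import Data.Nat.Induction using (<-wellFounded)
open import Data.Nat.Primality using (Prime; euclidsLemma; prime⇒nonTrivial)
open import Data.Nat.Properties
open import Data.Nat.Solver using (module +-*-Solver)
open import Data.Product using (∃₂; _×_; _,_)
open import Data.Rational as ℚ using (ℚ; ↥_; ↧ₙ_)
import Data.Rational.Properties as ℚ
open import Data.Sum using (inj₁; inj₂)
open import Induction.WellFounded using (Acc; acc)
open import Relation.Binary.PropositionalEquality
open import Relation.Nullary using (¬_; yes; no)

open import Defs
open import Algebra.Properties.CommutativeSemigroup *-commutativeSemigroup
  using (interchange; x∙yz≈yx∙z; x∙yz≈y∙xz; xy∙z≈xz∙y)
open +-*-Solver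

vpFuel-∤ : ∀ p .{{_ : NonTrivial p}} f m .{{_ : NonZero m}} → ¬ p ∣ m → vpFuel (suc f) p m ≡ 0
vpFuel-∤ p@(suc (suc _)) f m@(suc _) p∤m with p ∣? m
... | yes p∣m = ⊥-elim (p∤m p∣m)
... | no _    = refl

vpFuel-∣ : ∀ p .{{_ : NonTrivial p}} f m .{{_ : NonZero m}} (p∣m : p ∣ m) →
           vpFuel (suc f) p m ≡ suc (vpFuel f p (quotient p∣m))
vpFuel-∣ p@(suc (suc _)) f m@(suc _) p∣m@(divides q m≡q*p) with p ∣? m
... | no p∤m = ⊥-elim (p∤m p∣m)
... | yes _  = cong (λ x → suc (vpFuel f p x)) (trans (cong (_/ p) m≡q*p) (m*n/n≡m q p))

∤⇒≢0 : ∀ {p u} → ¬ p ∣ u → NonZero u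
∤⇒≢0 {p} {zero}  p∤0 = ⊥-elim (p∤0 (p ∣0))
∤⇒≢0 {u = suc _} _   = _

n<m^n : ∀ m .{{_ : NonTrivial m}} n → n < m ^ n
n<m^n m zero    = z<s
n<m^n m (suc n) = begin-strict
  suc n              ≤⟨ n<m^n m n ⟩
  m ^ n              <⟨ m<m*n (m ^ n) m (nonTrivial⇒n>1 m) ⟩
  m ^ n * m          ≡⟨ *-comm (m ^ n) m ⟩
  m * m ^ n          ∎
  where
  open ≤-Reasoning
  instance _ = m^n≢0 m n {{nonTrivial⇒nonZero m}}

vpFuel-p^v*u : ∀ p .{{_ : NonTrivial p}} {u} → ¬ p ∣ u → ∀ f v → v < f → vpFuel f p (p ^ v * u) ≡ v
vpFuel-p^v*u p {u} p∤u (suc f) zero    _ =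
  trans (cong (vpFuel (suc f) p) (*-identityˡ u)) (vpFuel-∤ p f u {{∤⇒≢0 p∤u}} p∤u)
vpFuel-p^v*u p {u} p∤u (suc f) (suc v) (s≤s v<f) = begin
  vpFuel (suc f) p (p * p ^ v * u)   ≡⟨ vpFuel-∣ p f _ {{p^v*u≢0}} p∣p*p^v*u ⟩
  suc (vpFuel f p (p ^ v * u))       ≡⟨ cong suc (vpFuel-p^v*u p p∤u f v v<f) ⟩
  suc v                              ∎
  where
  open ≡-Reasoning
  instance
    p≢0 = nonTrivial⇒nonZero p
    u≢0 = ∤⇒≢0 p∤u
  p^v*u≢0 : NonZero (p * p ^ v * u)
  p^v*u≢0 = m*n≢0 (p * p ^ v) u {{m^n≢0 p (suc v)}}
  p∣p*p^v*u : p ∣ p * p ^ v * u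
  p∣p*p^v*u = divides (p ^ v * u) (trans (*-assoc p (p ^ v) u) (*-comm p (p ^ v * u)))

vp-p^v*u : ∀ p .{{_ : NonTrivial p}} {u} v → ¬ p ∣ u → vp p (p ^ v * u) ≡ v
vp-p^v*u p {u} v p∤u = vpFuel-p^v*u p p∤u (p ^ v * u) v
  (<-≤-trans (n<m^n p v) (m≤m*n (p ^ v) u {{∤⇒≢0 p∤u}}))

p-adic-split : ∀ p .{{_ : NonTrivial p}} m .{{_ : NonZero m}} →
               ∃₂ λ v u → ¬ p ∣ u × m ≡ p ^ v * u
p-adic-split p m = split m (<-wellFounded m)
  where
  split : ∀ m .{{_ : NonZero m}} → Acc _<_ m → ∃₂ λ v u → ¬ p ∣ u × m ≡ p ^ v * u
  split m (acc rec) with p ∣? m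
  ... | no p∤m = 0 , m , p∤m , sym (*-identityˡ m)
  ... | yes (divides q m≡q*p) with split q {{q≢0}} (rec q<m)
    where
    q≢0 : NonZero q
    q≢0 = m*n≢0⇒m≢0 q {{>-nonZero (subst (0 <_) m≡q*p (>-nonZero⁻¹ m))}}
    q<m : q < m
    q<m = subst (q <_) (sym m≡q*p) (m<m*n q p {{q≢0}} (nonTrivial⇒n>1 p))
  ... | v , u , p∤u , q≡p^v*u = suc v , u , p∤u , (begin
    m                ≡⟨ m≡q*p ⟩
    q * p            ≡⟨ cong (_* p) q≡p^v*u ⟩
    p ^ v * u * p    ≡⟨ *-comm (p ^ v * u) p ⟩
    p * (p ^ v * u)  ≡⟨ *-assoc p (p ^ v) u ⟨
    p * p ^ v * u    ∎)
    where open ≡-Reasoning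

m≡p^v*u⇒vp≡v : ∀ p .{{_ : NonTrivial p}} {m u} v → ¬ p ∣ u → m ≡ p ^ v * u → vp p m ≡ v
m≡p^v*u⇒vp≡v p v p∤u refl = vp-p^v*u p v p∤u

p∤1 : ∀ p .{{_ : NonTrivial p}} → ¬ p ∣ 1
p∤1 p@(suc (suc _)) p∣1 with ∣1⇒≡1 p∣1
... | ()

vp-1 : ∀ p .{{_ : NonTrivial p}} → vp p 1 ≡ 0
vp-1 p = vp-p^v*u p 0 (p∤1 p)

vp-^ : ∀ p .{{_ : NonTrivial p}} e → vp p (p ^ e) ≡ e
vp-^ p e = m≡p^v*u⇒vp≡v p e (p∤1 p) (sym (*-identityʳ (p ^ e)))

vp-* : ∀ {p} → Prime p → ∀ x y .{{_ : NonZero x}} .{{_ : NonZero y}} → vp p (x * y) ≡ vp p x + vp p y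
vp-* {p} pr x y
  with p-adic-split p {{prime⇒nonTrivial pr}} x | p-adic-split p {{prime⇒nonTrivial pr}} y
... | a , u , p∤u , x≡ | b , w , p∤w , y≡ = begin
  vp p (x * y) ≡⟨ m≡p^v*u⇒vp≡v p (a + b) p∤uw x*y≡ ⟩
  a + b        ≡⟨ cong₂ _+_ (m≡p^v*u⇒vp≡v p a p∤u x≡) (m≡p^v*u⇒vp≡v p b p∤w y≡) ⟨
  vp p x + vp p y ∎
  where
  open ≡-Reasoning
  instance _ = prime⇒nonTrivial pr
  p∤uw : ¬ p ∣ u * w
  p∤uw p∣uw with euclidsLemma u w pr p∣uw
  ... | inj₁ p∣u = p∤u p∣u
  ... | inj₂ p∣w = p∤w p∣w
  x*y≡ : x * y ≡ p ^ (a + b) * (u * w)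
  x*y≡ = begin
    x * y                       ≡⟨ cong₂ _*_ x≡ y≡ ⟩
    p ^ a * u * (p ^ b * w)     ≡⟨ interchange (p ^ a) u (p ^ b) w ⟩
    p ^ a * p ^ b * (u * w)     ≡⟨ cong (_* (u * w)) (^-distribˡ-+-* p a b) ⟨
    p ^ (a + b) * (u * w)       ∎

vp-< : ∀ p .{{_ : NonTrivial p}} {m} .{{_ : NonZero m}} e → m < p ^ e → vp p m < e
vp-< p {m} e m<p^e with p-adic-split p m
... | a , u , p∤u , m≡p^a*u with e ≤? a
...   | no e≰a  = subst (_< e) (sym (m≡p^v*u⇒vp≡v p a p∤u m≡p^a*u)) (≰⇒> e≰a)
...   | yes e≤a = ⊥-elim (<-irrefl refl (begin-strict
  p ^ e     ≤⟨ ^-monoʳ-≤ p e≤a ⟩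
  p ^ a     ≤⟨ m≤m*n (p ^ a) u {{∤⇒≢0 p∤u}} ⟩
  p ^ a * u ≡⟨ m≡p^a*u ⟨
  m         <⟨ m<p^e ⟩
  p ^ e     ∎))
  where
  open ≤-Reasoning
  instance _ = nonTrivial⇒nonZero p

binomial : ∀ {n k} → k ≤ n → ℕ
binomial k≤n = quotient (k![n∸k]!∣n! k≤n)

n!≡binomial*[k!*[n∸k]!] : ∀ {n k} (k≤n : k ≤ n) → n ! ≡ binomial k≤n * (k ! * (n ∸ k) !)
n!≡binomial*[k!*[n∸k]!] k≤n = _∣_.equality (k![n∸k]!∣n! k≤n)

m≡n*o⇒n≢0 : ∀ {m} n o .{{_ : NonZero m}} → m ≡ n * o → NonZero n
m≡n*o⇒n≢0 {m} n o m≡n*o = m*n≢0⇒m≢0 n {{>-nonZero (subst (0 <_) m≡n*o (>-nonZero⁻¹ m))}}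

binomial≢0 : ∀ {n k} (k≤n : k ≤ n) → NonZero (binomial k≤n)
binomial≢0 {n} {k} k≤n = m≡n*o⇒n≢0 _ (k ! * (n ∸ k) !) {{n !≢0}} (n!≡binomial*[k!*[n∸k]!] k≤n)

binomial-absorption : ∀ {n m} (m≤n : m ≤ n) → binomial (s≤s m≤n) * suc m ≡ suc n * binomial m≤n
binomial-absorption {n} {m} m≤n = *-cancelʳ-≡ _ _ (m ! * (n ∸ m) !) {{m !* (n ∸ m) !≢0}} (begin
  C′ * suc m * (m ! * (n ∸ m) !)   ≡⟨ *-assoc C′ (suc m) _ ⟩
  C′ * (suc m * (m ! * (n ∸ m) !)) ≡⟨ cong (C′ *_) (*-assoc (suc m) (m !) _) ⟨
  C′ * (suc m ! * (n ∸ m) !)       ≡⟨ n!≡binomial*[k!*[n∸k]!] (s≤s m≤n) ⟨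
  suc n !                          ≡⟨ cong (suc n *_) (n!≡binomial*[k!*[n∸k]!] m≤n) ⟩
  suc n * (C * (m ! * (n ∸ m) !))  ≡⟨ *-assoc (suc n) C _ ⟨
  suc n * C * (m ! * (n ∸ m) !)    ∎)
  where
  open ≡-Reasoning
  C  = binomial m≤n
  C′ = binomial (s≤s m≤n)

vp-binomial>0 : ∀ {p} → Prime p → ∀ {n m} (m≤n : m ≤ n) .{{_ : NonZero m}} →
                vp p m < vp p n → 0 < vp p (binomial m≤n)
vp-binomial>0 {p} pr {suc n} {suc m} (s≤s m≤n) vp[m]<vp[n] = positive (begin
  vp p C′ + vp p (suc m)   ≡⟨ vp-* pr C′ (suc m) {{binomial≢0 (s≤s m≤n)}} ⟨
  vp p (C′ * suc m)        ≡⟨ cong (vp p) (binomial-absorption m≤n) ⟩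
  vp p (suc n * C)         ≡⟨ vp-* pr (suc n) C {{_}} {{binomial≢0 m≤n}} ⟩
  vp p (suc n) + vp p C    ∎)
  where
  open ≡-Reasoning
  C  = binomial m≤n
  C′ = binomial (s≤s m≤n)
  positive : ∀ {a b} → a + vp p (suc m) ≡ vp p (suc n) + b → 0 < a
  positive {zero}  {b} eq = ⊥-elim (<-irrefl eq (<-≤-trans vp[m]<vp[n] (m≤m+n (vp p (suc n)) b)))
  positive {suc _}     _  = z<s

ff*[m∸k]!≡m! : ∀ {m k} → k ≤ m → ff m k * (m ∸ k) ! ≡ m !
ff*[m∸k]!≡m! {m} {zero}  _    = *-identityˡ (m !)
ff*[m∸k]!≡m! {m} {suc k} k<m = begin
  ff m k * (m ∸ k) * (m ∸ suc k) !    ≡⟨ *-assoc (ff m k) (m ∸ k) _ ⟩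
  ff m k * ((m ∸ k) * (m ∸ suc k) !)  ≡⟨ cong (ff m k *_) ([n-k]*[n-k-1]!≡[n-k]! k<m) ⟩
  ff m k * (m ∸ k) !                  ≡⟨ ff*[m∸k]!≡m! (<⇒≤ k<m) ⟩
  m !                                 ∎
  where open ≡-Reasoning

ff≡k!*binomial : ∀ {m k} (k≤m : k ≤ m) → ff m k ≡ k ! * binomial k≤m
ff≡k!*binomial {m} {k} k≤m = *-cancelʳ-≡ _ _ ((m ∸ k) !) {{(m ∸ k) !≢0}} (begin
  ff m k * (m ∸ k) !                ≡⟨ ff*[m∸k]!≡m! k≤m ⟩
  m !                               ≡⟨ n!≡binomial*[k!*[n∸k]!] k≤m ⟩
  binomial k≤m * (k ! * (m ∸ k) !)  ≡⟨ x∙yz≈yx∙z (binomial k≤m) (k !) _ ⟩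
  k ! * binomial k≤m * (m ∸ k) !    ∎)
  where open ≡-Reasoning

ff≢0 : ∀ {m k} → k ≤ m → NonZero (ff m k)
ff≢0 {m} {k} k≤m = m≡n*o⇒n≢0 (ff m k) ((m ∸ k) !) {{m !≢0}} (sym (ff*[m∸k]!≡m! k≤m))

ff[n,n]≡n! : ∀ n → ff n n ≡ n !
ff[n,n]≡n! n = begin
  ff n n             ≡⟨ *-identityʳ (ff n n) ⟨
  ff n n * 1         ≡⟨ cong (λ t → ff n n * t !) (n∸n≡0 n) ⟨
  ff n n * (n ∸ n) ! ≡⟨ ff*[m∸k]!≡m! (≤-refl {n}) ⟩
  n !                ∎
  where open ≡-Reasoning

ff*binomial≡ff*binomial : ∀ r {n k} (k≤n : k ≤ n) →
  ff n k * binomial (m≤n+m n r) ≡ ff (r + k) k * binomial (+-monoʳ-≤ r k≤n)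
ff*binomial≡ff*binomial r {n} {k} k≤n = *-cancelʳ-≡ _ _ ((n ∸ k) ! * r !) {{(n ∸ k) !* r !≢0}} (begin
  ff n k * K * ((n ∸ k) ! * r !)            ≡⟨ interchange (ff n k) K _ _ ⟩
  ff n k * (n ∸ k) ! * (K * r !)            ≡⟨ cong (_* (K * r !)) (ff*[m∸k]!≡m! k≤n) ⟩
  n ! * (K * r !)                           ≡⟨ x∙yz≈y∙xz (n !) K (r !) ⟩
  K * (n ! * r !)                           ≡⟨ cong (λ t → K * (n ! * t !)) (m+n∸n≡m r n) ⟨
  K * (n ! * (r + n ∸ n) !)                 ≡⟨ n!≡binomial*[k!*[n∸k]!] (m≤n+m n r) ⟨
  (r + n) !                                 ≡⟨ n!≡binomial*[k!*[n∸k]!] (+-monoʳ-≤ r k≤n) ⟩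
  M * ((r + k) ! * (r + n ∸ (r + k)) !)     ≡⟨ cong₂ (λ s t → M * (s * t !)) [r+k]!≡ff*r! ([m+n]∸[m+o]≡n∸o r n k) ⟩
  M * (ff (r + k) k * r ! * (n ∸ k) !)      ≡⟨ x[yzw]≡yx[wz] M (ff (r + k) k) (r !) _ ⟩
  ff (r + k) k * M * ((n ∸ k) ! * r !)      ∎)
  where
  open ≡-Reasoning
  K = binomial (m≤n+m n r)
  M = binomial (+-monoʳ-≤ r k≤n)
  [r+k]!≡ff*r! : (r + k) ! ≡ ff (r + k) k * r !
  [r+k]!≡ff*r! = trans (sym (ff*[m∸k]!≡m! (m≤n+m k r))) (cong (λ t → ff (r + k) k * t !) (m+n∸n≡m r k))
  x[yzw]≡yx[wz] : ∀ x y z w → x * (y * z * w) ≡ y * x * (w * z)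
  x[yzw]≡yx[wz] = solve 4 (λ x y z w → x :* (y :* z :* w) := y :* x :* (w :* z)) refl

↥↧-coprime : (q : ℚ) → Coprime ∣ ↥ q ∣ (↧ₙ q)
↥↧-coprime (ℚ.mkℚ _ _ coprime) = Coprimality.recompute coprime

frac-cross : ∀ a b {c d} .{{_ : NonZero b}} → a * d ≡ b * c →
             ∣ ↥ frac a b ∣ * d ≡ ↧ₙ frac a b * c
frac-cross a b@(suc _) {c} {d} ad≡bc = *-cancelʳ-≡ _ _ g {{g≢0}} (begin
  num * d * g   ≡⟨ xy∙z≈xz∙y num d g ⟩
  num * g * d   ≡⟨ cong (_* d) num*g≡a ⟩
  a * d         ≡⟨ ad≡bc ⟩
  b * c         ≡⟨ cong (_* c) den*g≡b ⟨
  den * g * c   ≡⟨ xy∙z≈xz∙y den g c ⟩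
  den * c * g   ∎)
  where
  open ≡-Reasoning
  num = ∣ ↥ frac a b ∣
  den = ↧ₙ frac a b
  g = gcd a b
  num*g≡a : num * g ≡ a
  num*g≡a = trans (sym (ℤ.abs-* (↥ frac a b) (+ g))) (cong ∣_∣ (ℚ.↥-normalize a b))
  den*g≡b : den * g ≡ b
  den*g≡b = trans (sym (ℤ.abs-* (ℚ.↧ frac a b) (+ g))) (cong ∣_∣ (ℚ.↧-normalize a b))
  g≢0 : NonZero g
  g≢0 = m*n≢0⇒n≢0 den {{>-nonZero (subst (0 <_) (sym den*g≡b) z<s)}}

↧ₙ-frac-∣ : ∀ a b {c d} .{{_ : NonZero b}} → a * d ≡ b * c → ↧ₙ frac a b ∣ d
↧ₙ-frac-∣ a b {c} ad≡bc = coprime-divisor (Coprimality.sym (↥↧-coprime (frac a b)))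
  (divides c (trans (frac-cross a b ad≡bc) (*-comm (↧ₙ frac a b) c)))

↧ₙ-frac[a,a*d] : ∀ a d .{{_ : NonZero a}} .{{_ : NonZero d}} → ↧ₙ frac a (a * d) ≡ d
↧ₙ-frac[a,a*d] a d = ∣-antisym (↧ₙ-frac-∣ a (a * d) ad≡ad*1) (divides (∣ ↥ frac a (a * d) ∣) (begin
  ↧ₙ frac a (a * d)              ≡⟨ *-identityʳ _ ⟨
  ↧ₙ frac a (a * d) * 1          ≡⟨ frac-cross a (a * d) ad≡ad*1 ⟨
  ∣ ↥ frac a (a * d) ∣ * d       ∎))
  where
  open ≡-Reasoning
  instance _ = m*n≢0 a d
  ad≡ad*1 : a * d ≡ a * d * 1
  ad≡ad*1 = sym (*-identityʳ (a * d))

frac[a*d,a] : ∀ a d .{{_ : NonZero a}} → ∣ ↥ frac (a * d) a ∣ ≡ d × ↧ₙ frac (a * d) a ≡ 1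
frac[a*d,a] a d = num≡d , den≡1
  where
  open ≡-Reasoning
  ad*1≡ad : a * d * 1 ≡ a * d
  ad*1≡ad = *-identityʳ (a * d)
  den≡1 : ↧ₙ frac (a * d) a ≡ 1
  den≡1 = ∣1⇒≡1 (↧ₙ-frac-∣ (a * d) a ad*1≡ad)
  num≡d : ∣ ↥ frac (a * d) a ∣ ≡ d
  num≡d = begin
    ∣ ↥ frac (a * d) a ∣       ≡⟨ *-identityʳ _ ⟨
    ∣ ↥ frac (a * d) a ∣ * 1   ≡⟨ frac-cross (a * d) a ad*1≡ad ⟩
    ↧ₙ frac (a * d) a * d      ≡⟨ cong (_* d) den≡1 ⟩
    1 * d                      ≡⟨ *-identityˡ d ⟩
    d                          ∎

m<n+o⇒+m-+n<+o : ∀ {m n o} → m < n + o → + m ℤ.- + n ℤ.< + o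
m<n+o⇒+m-+n<+o {m} {n} {o} m<n+o = begin-strict
  + m ℤ.- + n   ≡⟨ ℤ.m-n≡m⊖n m n ⟩
  m ℤ.⊖ n       <⟨ ℤ.⊖-monoˡ-< n m<n+o ⟩
  (n + o) ℤ.⊖ n ≡⟨ ℤ.≤-⊖ (m≤m+n n o) ⟩
  + (n + o ∸ n) ≡⟨ cong +_ (m+n∸m≡n n o) ⟩
  + o           ∎
  where open ℤ.≤-Reasoning

ord-frac[a*d,a] : ∀ p .{{_ : NonTrivial p}} a d .{{_ : NonZero a}} → ord p (frac (a * d) a) ≡ + vp p d
ord-frac[a*d,a] p a d with frac[a*d,a] a d
... | num≡d , den≡1 = begin
  + vp p (∣ ↥ frac (a * d) a ∣) ℤ.- + vp p (↧ₙ frac (a * d) a) ≡⟨ cong₂ (λ x y → + vp p x ℤ.- + vp p y) num≡d den≡1 ⟩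
  + vp p d ℤ.- + vp p 1                                         ≡⟨ cong (λ v → + vp p d ℤ.- + v) (vp-1 p) ⟩
  + vp p d ℤ.+ + 0                                              ≡⟨ ℤ.+-identityʳ (+ vp p d) ⟩
  + vp p d                                                      ∎
  where open ≡-Reasoning

ord-frac-< : ∀ {p} → Prime p → ∀ a b {c d} .{{_ : NonZero b}} .{{_ : NonZero d}} →
             a * c ≡ b * d → 0 < vp p c → ord p (frac a b) ℤ.< + vp p d
ord-frac-< {p} pr a b {c} {d} ac≡bd 0<vp[c] = m<n+o⇒+m-+n<+o (begin-strict
  vp p num                <⟨ m<m+n (vp p num) 0<vp[c] ⟩
  vp p num + vp p c       ≡⟨ vp-* pr num c {{num≢0}} {{c≢0}} ⟨
  vp p (num * c)          ≡⟨ cong (vp p) (frac-cross a b ac≡bd) ⟩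
  vp p (den * d)          ≡⟨ vp-* pr den d ⟩
  vp p den + vp p d       ∎)
  where
  open ≤-Reasoning
  num = ∣ ↥ frac a b ∣
  den = ↧ₙ frac a b
  num*c≢0 : NonZero (num * c)
  num*c≢0 = subst NonZero (sym (frac-cross a b ac≡bd)) (m*n≢0 den d)
  num≢0 : NonZero num
  num≢0 = m*n≢0⇒m≢0 num {{num*c≢0}}
  c≢0 : NonZero c
  c≢0 = m*n≢0⇒n≢0 num {{num*c≢0}}

↧ₙ-frac[ff[n,n],ff[r+n,n]] : ∀ r n → ↧ₙ frac (ff n n) (ff (r + n) n) ≡ binomial (m≤n+m n r)
↧ₙ-frac[ff[n,n],ff[r+n,n]] r n = begin
  ↧ₙ frac (ff n n) (ff (r + n) n) ≡⟨ cong₂ (λ a b → ↧ₙ frac a b) (ff[n,n]≡n! n) (ff≡k!*binomial (m≤n+m n r)) ⟩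
  ↧ₙ frac (n !) (n ! * K)         ≡⟨ ↧ₙ-frac[a,a*d] (n !) K {{n !≢0}} {{binomial≢0 (m≤n+m n r)}} ⟩
  K                               ∎
  where
  open ≡-Reasoning
  K = binomial (m≤n+m n r)

ord-frac[ff[r+n,n],n!] : ∀ p .{{_ : NonTrivial p}} r n →
  ord p (frac (ff (r + n) n) (n !)) ≡ + vp p (binomial (m≤n+m n r))
ord-frac[ff[r+n,n],n!] p r n =
  trans (cong (λ b → ord p (frac b (n !))) (ff≡k!*binomial (m≤n+m n r)))
        (ord-frac[a*d,a] p (n !) _ {{n !≢0}})

↧ₙ-frac[ff,ff]-∣ : ∀ r {n k} → k ≤ n →
  ↧ₙ frac (ff n k) (ff (r + k) k) ∣ ↧ₙ frac (ff n n) (ff (r + n) n)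
↧ₙ-frac[ff,ff]-∣ r {n} {k} k≤n = subst (↧ₙ frac (ff n k) (ff (r + k) k) ∣_)
  (sym (↧ₙ-frac[ff[n,n],ff[r+n,n]] r n))
  (↧ₙ-frac-∣ (ff n k) (ff (r + k) k) {{ff≢0 (m≤n+m k r)}} (ff*binomial≡ff*binomial r k≤n))

ord-frac[ff,ff]-< : ∀ {p e} → Prime p → ∀ r {n} .{{_ : NonZero r}} → r + n ≡ p ^ e →
  ∀ {k} → k < n → ord p (frac (ff (r + k) k) (ff n k)) ℤ.< ord p (frac (ff (r + n) n) (n !))
ord-frac[ff,ff]-< {p} {e} pr r {n} r+n≡p^e {k} k<n =
  subst (ord p (frac (ff (r + k) k) (ff n k)) ℤ.<_) (sym (ord-frac[ff[r+n,n],n!] p r n))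
    (ord-frac-< pr (ff (r + k) k) (ff n k) {{ff≢0 k≤n}} {{binomial≢0 (m≤n+m n r)}}
      (sym (ff*binomial≡ff*binomial r k≤n))
      (vp-binomial>0 pr (+-monoʳ-≤ r k≤n) vp[r+k]<vp[r+n]))
  where
  k≤n = <⇒≤ k<n
  instance
    p-nonTrivial = prime⇒nonTrivial pr
    r+k≢0 = >-nonZero (≤-trans (>-nonZero⁻¹ r) (m≤m+n r k))
  vp[r+k]<vp[r+n] : vp p (r + k) < vp p (r + n)
  vp[r+k]<vp[r+n] = subst (vp p (r + k) <_) (sym (trans (cong (vp p) r+n≡p^e) (vp-^ p e)))
    (vp-< p e (subst (r + k <_) r+n≡p^e (+-monoʳ-< r k<n)))

lemma4p10 : (n r : ℕ) → 1 ≤ n → 1 ≤ r →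
    ((k : ℕ) → k ≤ n →
      ↧ₙ (frac (ff n k) (ff (r + k) k)) ∣ ↧ₙ (frac (ff n n) (ff (r + n) n)))
    × ((p e : ℕ) → Prime p → 1 ≤ e → n + r ≡ p ^ e →
      (k : ℕ) → k < n →
      ord p (frac (ff (r + n) n) (n !)) > ord p (frac (ff (r + k) k) (ff n k)))
lemma4p10 n r _ 0<r =
  (λ k → ↧ₙ-frac[ff,ff]-∣ r) ,
  (λ p e p-prime _ n+r≡p^e k →
    ord-frac[ff,ff]-< {e = e} p-prime r {{>-nonZero 0<r}} (trans (+-comm r n) n+r≡p^e))
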